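{- Let $G$ be a finite, simple, loopless, regular, connected graph, and let $r$ be a positive integer with $r \leq \operatorname{diam}(G)$. Then \[ e(G^{r}) \geq \left( \left\lceil \frac{r}{3} \right\rceil -1 \right) e(G). \]
   Context: For vertices $u,v$ of $G$, $\operatorname{dist}(u,v)$ is the length of a shortest path between them. The $r$th power $G^r$ of $G$ is the graph on $V(G)$ in which two distinct vertices $x,y$ are adjacent if and only if $\operatorname{dist}(x,y)\leq r$ in $G$. The diameter $\operatorname{diam}(G)$ is the maximum distance between two vertices of $G$ (equivalently the least $r$ such that $G^r$ is complete). $e(H)$ denotes the number of edges of a graph $H$. -}

module Defs where

open import Data.Nat using (ℕ; zero; suc; _+_; _<ᵇ_; _∸_)
open import Data.Bool using (Bool; true; false; _∧_; _∨_; not; if_then_else_)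
open import Data.Nat using (_/_)
open import Data.Fin using (Fin; toℕ)
open import Data.Fin.Properties using (_≟_)
open import Data.List using (List; map; allFin)
open import Data.Nat.ListAction using (sum)
open import Data.Bool.ListAction using (any)
open import Relation.Nullary.Decidable using (⌊_⌋)
open import Relation.Binary.PropositionalEquality using (_≡_)
open import Data.Product using (Σ; ∃; ∃-syntax; _×_)

record Graph (n : ℕ) : Set where
  field
    adj   : Fin n → Fin n → Bool
    sym   : ∀ u v → adj u v ≡ adj v u
    loopless : ∀ v → adj v v ≡ false
open Graph public

count : ∀ {n} → (Fin n → Bool) → ℕ
count {n} p = sum (map (λ x → if p x then 1 else 0) (allFin n))

degree : ∀ {n} → Graph n → Fin n → ℕ
degree G v = count (adj G v)

-- within G r u v = true  iff  dist(u,v) ≤ r in G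
-- (there is a walk of length at most r from u to v)
within : ∀ {n} → Graph n → ℕ → Fin n → Fin n → Bool
within G zero    u v = ⌊ u ≟ v ⌋
within G (suc r) u v = within G r u v ∨ any (λ w → adj G u w ∧ within G r w v) (allFin _)

Regular : ∀ {n} → Graph n → Set
Regular G = ∃[ d ] (∀ v → degree G v ≡ d)

Connected : ∀ {n} → Graph n → Set
Connected G = ∀ u v → ∃[ r ] (within G r u v ≡ true)

-- diam(G) ≥ r  iff some pair of vertices is at distance > r - 1
DiamAtLeast : ∀ {n} → Graph n → ℕ → Set
DiamAtLeast G r = ∃[ u ] ∃[ v ] (within G (r ∸ 1) u v ≡ false)

edgeCount : ∀ {n} → (Fin n → Fin n → Bool) → ℕ
edgeCount {n} a = sum (map (λ u → count (λ v → (toℕ u <ᵇ toℕ v) ∧ a u v)) (allFin n))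

e : ∀ {n} → Graph n → ℕ
e G = edgeCount (adj G)

powAdj : ∀ {n} → Graph n → ℕ → Fin n → Fin n → Bool
powAdj G r x y = not ⌊ x ≟ y ⌋ ∧ within G r x y

ePow : ∀ {n} → Graph n → ℕ → ℕ
ePow G r = edgeCount (powAdj G r)

ceil3 : ℕ → ℕ
ceil3 r = (r + 2) / 3

module Submission where

-- Write B(v,t) for the ball of radius t around v.  If some vertex x lies at
-- distance exactly t+1 from v, then x together with its d neighbours lies in
-- B(v,t+2), and both are disjoint from B(v,t-1); hence a ball gains at least
-- d+1 vertices every three steps of the radius.  Iterating, for every vertex v
-- the ball B(v, 3j+2) has at least (j+1)(d+1) vertices, unless it already
-- contains all of G (the ball stopped growing, and G is connected).  The latter
-- cannot happen around a vertex u having a vertex at distance ≥ r from u, so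
-- in that case too |B(v,3j+2)| = n ≥ |B(u,3j+2)| ≥ (j+1)(d+1).  Therefore
-- every vertex has degree ≥ (j+1)(d+1) - 1 ≥ (j+1)d in G^r when 3j+2 ≤ r-1,
-- and by the handshake lemma 2 e(G^r) ≥ n (j+1) d = (j+1) · 2 e(G).

open import Defs hiding (sym)
open import Data.Nat using (ℕ; _≤_; _*_; _∸_)
open import Data.Nat.Base using (zero; suc; _+_; _<_; _<ᵇ_; z≤n; s≤s; _/_; _≤′_; ≤′-refl; ≤′-step)
open import Data.Nat.Properties hiding (_≟_; suc-injective)
open import Data.Nat.DivMod using (m/n*n≤m)
open import Data.Nat.ListAction using (sum)
open import Data.Bool.Base using (Bool; true; false; _∧_; _∨_; not; if_then_else_; T)
open import Data.Bool.Properties as Bool using (∧-conicalˡ; ∧-conicalʳ; ∨-zeroʳ; T-≡)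
open import Data.Bool.ListAction using (any)
open import Data.Fin.Base using (Fin; toℕ) renaming (zero to fzero; suc to fsuc)
open import Data.Fin.Properties using (_≟_; toℕ-injective; suc-injective; any?)
open import Data.List.Base using (map; allFin; tabulate)
open import Data.List.Properties using (map-tabulate)
open import Data.List.Relation.Unary.Any using (satisfied)
open import Data.List.Relation.Unary.Any.Properties using (any⁺; any⁻)
open import Data.List.Membership.Propositional using (lose)
open import Data.List.Membership.Propositional.Properties using (∈-allFin)
open import Data.Product using (∃-syntax; _×_; _,_; proj₂)
open import Data.Sum using (_⊎_; inj₁; inj₂)
open import Data.Empty using (⊥; ⊥-elim)
open import Function using (_∘_; id)
open import Function.Bundles using (Equivalence)
open import Relation.Nullary using (¬_; yes; no)
open import Relation.Nullary.Decidable using (⌊_⌋; _×-dec_)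
open import Relation.Binary.Definitions using (tri<; tri≈; tri>)
open import Relation.Binary.PropositionalEquality
open import Algebra.Properties.CommutativeMonoid.Sum +-0-commutativeMonoid
  using (sum-syntax; ∑-distrib-+; ∑-comm; sum-cong-≗)
  renaming (sum to ∑)
open import Algebra.Properties.CommutativeSemigroup *-commutativeSemigroup using (x∙yz≈y∙xz)

T⇒≡ : ∀ {b} → T b → b ≡ true
T⇒≡ = Equivalence.to T-≡

≡⇒T : ∀ {b} → b ≡ true → T b
≡⇒T = Equivalence.from T-≡

true≢false : ∀ {b} → b ≡ true → b ≡ false → ⊥
true≢false refl ()

any-allFin⁻ : ∀ {n} (p : Fin n → Bool) → any p (allFin n) ≡ true → ∃[ x ] p x ≡ true
any-allFin⁻ {n} p h with satisfied (any⁻ p (allFin n) (≡⇒T h))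
... | x , px = x , T⇒≡ px

any-allFin⁺ : ∀ {n} (p : Fin n → Bool) x → p x ≡ true → any p (allFin n) ≡ true
any-allFin⁺ p x px = T⇒≡ (any⁺ p (lose (∈-allFin x) (≡⇒T px)))

≟-refl : ∀ {n} (x : Fin n) → ⌊ x ≟ x ⌋ ≡ true
≟-refl x with x ≟ x
... | yes _  = refl
... | no x≢x = ⊥-elim (x≢x refl)

≟-sound : ∀ {n} {x y : Fin n} → ⌊ x ≟ y ⌋ ≡ true → x ≡ y
≟-sound {x = x} {y} h with x ≟ y
... | yes x≡y = x≡y

≟-sym : ∀ {n} (x y : Fin n) → ⌊ x ≟ y ⌋ ≡ ⌊ y ≟ x ⌋
≟-sym x y with x ≟ y | y ≟ x
... | yes _   | yes _   = refl
... | no _    | no _    = refl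
... | yes x≡y | no y≢x  = ⊥-elim (y≢x (sym x≡y))
... | no x≢y  | yes y≡x = ⊥-elim (x≢y (sym y≡x))

≟-suc : ∀ {n} (x y : Fin n) → ⌊ fsuc x ≟ fsuc y ⌋ ≡ ⌊ x ≟ y ⌋
≟-suc x y with x ≟ y | fsuc x ≟ fsuc y
... | yes _   | yes _   = refl
... | no _    | no _    = refl
... | yes x≡y | no sx≢sy = ⊥-elim (sx≢sy (cong fsuc x≡y))
... | no x≢y  | yes sx≡sy = ⊥-elim (x≢y (suc-injective sx≡sy))

<ᵇ-true : ∀ {m n} → m < n → (m <ᵇ n) ≡ true
<ᵇ-true m<n = T⇒≡ (<⇒<ᵇ m<n)

<ᵇ-false : ∀ {m n} → ¬ m < n → (m <ᵇ n) ≡ false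
<ᵇ-false {m} {n} m≮n with m <ᵇ n in eq
... | true  = ⊥-elim (m≮n (<ᵇ⇒< m n (≡⇒T eq)))
... | false = refl

𝟙 : Bool → ℕ
𝟙 b = if b then 1 else 0

sum-allFin : ∀ {n} (f : Fin n → ℕ) → sum (map f (allFin n)) ≡ ∑[ x < n ] f x
sum-allFin f = trans (cong sum (map-tabulate id f)) (sum-tabulate f)
  where
  sum-tabulate : ∀ {m} (g : Fin m → ℕ) → sum (tabulate g) ≡ ∑[ x < m ] g x
  sum-tabulate {zero}  g = refl
  sum-tabulate {suc m} g = cong (g fzero +_) (sum-tabulate (g ∘ fsuc))

count-as-∑ : ∀ {n} (p : Fin n → Bool) → count p ≡ ∑[ x < n ] 𝟙 (p x)
count-as-∑ p = sum-allFin (𝟙 ∘ p)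

∑-mono : ∀ {n} {f g : Fin n → ℕ} → (∀ x → f x ≤ g x) → ∑[ x < n ] f x ≤ ∑[ x < n ] g x
∑-mono {zero}  f≤g = z≤n
∑-mono {suc n} f≤g = +-mono-≤ (f≤g fzero) (∑-mono (f≤g ∘ fsuc))

∑-const : ∀ n c → ∑[ x < n ] c ≡ n * c
∑-const zero    c = refl
∑-const (suc n) c = cong (c +_) (∑-const n c)

count-mono : ∀ {n} {p q : Fin n → Bool} → (∀ y → p y ≡ true → q y ≡ true) → count p ≤ count q
count-mono {p = p} {q} p⊆q = begin
  count p            ≡⟨ count-as-∑ p ⟩
  ∑[ y < _ ] 𝟙 (p y) ≤⟨ ∑-mono (λ y → 𝟙-mono (p y) (q y) (p⊆q y)) ⟩
  ∑[ y < _ ] 𝟙 (q y) ≡⟨ count-as-∑ q ⟨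
  count q            ∎
  where
  open ≤-Reasoning
  𝟙-mono : ∀ a b → (a ≡ true → b ≡ true) → 𝟙 a ≤ 𝟙 b
  𝟙-mono true  b a⇒b rewrite a⇒b refl = ≤-refl
  𝟙-mono false b a⇒b = z≤n

count-all : ∀ n → count {n} (λ _ → true) ≡ n
count-all n = trans (count-as-∑ {n} (λ _ → true)) (trans (∑-const n 1) (*-identityʳ n))

count≤n : ∀ {n} (p : Fin n → Bool) → count p ≤ n
count≤n {n} p = subst (count p ≤_) (count-all n) (count-mono {p = p} {q = λ _ → true} (λ _ _ → refl))

count-∪ : ∀ {n} (p q : Fin n → Bool) → (∀ y → p y ≡ true → q y ≡ false) →
          count p + count q ≡ count (λ y → p y ∨ q y)
count-∪ p q disjoint = begin
  count p + count q                          ≡⟨ cong₂ _+_ (count-as-∑ p) (count-as-∑ q) ⟩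
  ∑[ y < _ ] 𝟙 (p y) + ∑[ y < _ ] 𝟙 (q y)    ≡⟨ ∑-distrib-+ (𝟙 ∘ p) (𝟙 ∘ q) ⟨
  ∑[ y < _ ] (𝟙 (p y) + 𝟙 (q y))             ≡⟨ sum-cong-≗ (λ y → 𝟙-∨ (p y) (q y) (disjoint y)) ⟩
  ∑[ y < _ ] 𝟙 (p y ∨ q y)                   ≡⟨ count-as-∑ (λ y → p y ∨ q y) ⟨
  count (λ y → p y ∨ q y)                    ∎
  where
  open ≡-Reasoning
  𝟙-∨ : ∀ a b → (a ≡ true → b ≡ false) → 𝟙 a + 𝟙 b ≡ 𝟙 (a ∨ b)
  𝟙-∨ true  b a⇒¬b rewrite a⇒¬b refl = refl
  𝟙-∨ false b a⇒¬b = refl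

count-≟ : ∀ {n} (x : Fin n) → count (λ y → ⌊ x ≟ y ⌋) ≡ 1
count-≟ x = trans (count-as-∑ (λ y → ⌊ x ≟ y ⌋)) (∑-delta x)
  where
  ∑-delta : ∀ {n} (x : Fin n) → ∑[ y < n ] 𝟙 ⌊ x ≟ y ⌋ ≡ 1
  ∑-delta {suc n} fzero    = cong suc (trans (∑-const n 0) (*-zeroʳ n))
  ∑-delta {suc n} (fsuc x) = trans (sum-cong-≗ (λ y → cong 𝟙 (≟-suc x y))) (∑-delta x)

handshake : ∀ {n} (a : Fin n → Fin n → Bool) →
            (∀ u v → a u v ≡ a v u) → (∀ v → a v v ≡ false) →
            2 * edgeCount a ≡ ∑[ u < n ] count (a u)
handshake {n} a a-sym a-irrefl = sym (begin
  ∑[ u < n ] count (a u)                                  ≡⟨ sum-cong-≗ (λ u → count-as-∑ (a u)) ⟩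
  ∑[ u < n ] ∑[ v < n ] 𝟙 (a u v)                         ≡⟨ sum-cong-≗ (λ u → sum-cong-≗ (split u)) ⟩
  ∑[ u < n ] ∑[ v < n ] (E u v + E v u)                   ≡⟨ sum-cong-≗ (λ u → ∑-distrib-+ (E u) (λ v → E v u)) ⟩
  ∑[ u < n ] (∑[ v < n ] E u v + ∑[ v < n ] E v u)        ≡⟨ ∑-distrib-+ (λ u → ∑[ v < n ] E u v) _ ⟩
  ∑[ u < n ] ∑[ v < n ] E u v + ∑[ u < n ] ∑[ v < n ] E v u ≡⟨ cong (ΣE +_) (∑-comm (λ v u → E v u)) ⟨
  ΣE + ΣE                                                 ≡⟨ cong (λ m → m + m) edgeCount≡ΣE ⟨
  edgeCount a + edgeCount a                               ≡⟨ cong (edgeCount a +_) (+-identityʳ _) ⟨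
  2 * edgeCount a                                         ∎)
  where
  open ≡-Reasoning
  -- E u v counts the pair {u,v} as an edge seen from its smaller endpoint u.
  E : Fin n → Fin n → ℕ
  E u v = 𝟙 ((toℕ u <ᵇ toℕ v) ∧ a u v)

  ΣE : ℕ
  ΣE = ∑[ u < n ] ∑[ v < n ] E u v

  edgeCount≡ΣE : edgeCount a ≡ ΣE
  edgeCount≡ΣE = trans (sum-allFin (λ u → count (λ v → (toℕ u <ᵇ toℕ v) ∧ a u v)))
                       (sum-cong-≗ (λ u → count-as-∑ (λ v → (toℕ u <ᵇ toℕ v) ∧ a u v)))

  -- Each ordered adjacent pair is the pair seen from exactly one endpoint.
  split : ∀ u v → 𝟙 (a u v) ≡ E u v + E v u
  split u v with <-cmp (toℕ u) (toℕ v)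
  ... | tri< u<v _ v≮u rewrite <ᵇ-true u<v | <ᵇ-false v≮u = sym (+-identityʳ _)
  ... | tri> u≮v _ v<u rewrite <ᵇ-false u≮v | <ᵇ-true v<u = cong 𝟙 (a-sym u v)
  ... | tri≈ _ u≡v _ with toℕ-injective u≡v
  ...   | refl rewrite <ᵇ-false (<-irrefl {toℕ u} refl) | a-irrefl u = refl

-- Balls in a graph: `within G t v` is the ball B(v,t).

module Balls {n : ℕ} (G : Graph n) where

  within-suc-elim : ∀ r u v → within G (suc r) u v ≡ true →
                    within G r u v ≡ true ⊎ ∃[ w ] (adj G u w ≡ true × within G r w v ≡ true)
  within-suc-elim r u v h with within G r u v
  ... | true  = inj₁ refl
  ... | false with any-allFin⁻ _ h
  ...   | w , uw∧wv = inj₂ (w , ∧-conicalˡ _ _ uw∧wv , ∧-conicalʳ _ _ uw∧wv)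

  within-suc : ∀ r u v → within G r u v ≡ true → within G (suc r) u v ≡ true
  within-suc r u v h rewrite h = refl

  within-cons : ∀ r u w v → adj G u w ≡ true → within G r w v ≡ true → within G (suc r) u v ≡ true
  within-cons r u w v uw wv =
    trans (cong (within G r u v ∨_) (any-allFin⁺ _ w (cong₂ _∧_ uw wv))) (∨-zeroʳ _)

  within-mono : ∀ {r s} → r ≤ s → ∀ u v → within G r u v ≡ true → within G s u v ≡ true
  within-mono {r} r≤s u v h = grow (≤⇒≤′ r≤s)
    where
    grow : ∀ {s} → r ≤′ s → within G s u v ≡ true
    grow ≤′-refl            = h
    grow (≤′-step {s} r≤′s) = within-suc s u v (grow r≤′s)

  within-snoc : ∀ r u w x → within G r u w ≡ true → adj G w x ≡ true → within G (suc r) u x ≡ true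
  within-snoc zero    u w x uw wx with ≟-sound {x = u} uw
  ... | refl = within-cons zero u x x wx (≟-refl x)
  within-snoc (suc r) u w x uw wx with within-suc-elim r u w uw
  ... | inj₁ uw′ = within-suc (suc r) u x (within-snoc r u w x uw′ wx)
  ... | inj₂ (u′ , uu′ , u′w) = within-cons (suc r) u u′ x uu′ (within-snoc r u′ w x u′w wx)

  within-sym : ∀ r u v → within G r u v ≡ true → within G r v u ≡ true
  within-sym zero    u v h rewrite ≟-sym u v = h
  within-sym (suc r) u v h with within-suc-elim r u v h
  ... | inj₁ uv = within-suc r v u (within-sym r u v uv)
  ... | inj₂ (w , uw , wv) = within-snoc r v w u (within-sym r w v wv) (trans (Graph.sym G w u) uw)

  within-comm : ∀ r u v → within G r u v ≡ within G r v u
  within-comm r u v with within G r u v in uv | within G r v u in vu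
  ... | true  | true  = refl
  ... | false | false = refl
  ... | true  | false = ⊥-elim (true≢false (within-sym r u v uv) vu)
  ... | false | true  = ⊥-elim (true≢false (within-sym r v u vu) uv)

  within-suc-elimʳ : ∀ r v x → within G (suc r) v x ≡ true →
                     within G r v x ≡ true ⊎ ∃[ w ] (within G r v w ≡ true × adj G w x ≡ true)
  within-suc-elimʳ r v x h with within-suc-elim r x v (within-sym (suc r) v x h)
  ... | inj₁ xv = inj₁ (within-sym r x v xv)
  ... | inj₂ (w , xw , wv) = inj₂ (w , within-sym r w v wv , trans (Graph.sym G w x) xw)

  Stable : Fin n → ℕ → Set
  Stable v t = ∀ y → within G (suc t) v y ≡ true → within G t v y ≡ true

  AtDistance : Fin n → ℕ → Fin n → Set
  AtDistance v t x = within G (suc t) v x ≡ true × within G t v x ≡ false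

  grows-or-stable : ∀ v t → ∃[ x ] AtDistance v t x ⊎ Stable v t
  grows-or-stable v t
    with any? (λ y → (within G (suc t) v y Bool.≟ true) ×-dec (within G t v y Bool.≟ false))
  ... | yes far = inj₁ far
  ... | no ¬far = inj₂ stable
    where
    stable : Stable v t
    stable y h with within G t v y Bool.≟ true
    ... | yes vy  = vy
    ... | no ¬vy  = ⊥-elim (¬far (y , h , Bool.¬-not ¬vy))

  stable-full : Connected G → ∀ v t → Stable v t → ∀ y → within G t v y ≡ true
  stable-full connected v t stable y with connected v y
  ... | m , vy = shrink m y (within-mono (m≤m+n m t) v y vy)
    where
    shrink : ∀ i y → within G (i + t) v y ≡ true → within G t v y ≡ true
    shrink zero    y h = h
    shrink (suc i) y h with within-suc-elimʳ (i + t) v y h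
    ... | inj₁ vy′ = shrink i y vy′
    ... | inj₂ (w , vw , wy) = stable y (within-snoc t v w y (shrink i w vw) wy)

  powAdj-sym : ∀ r x y → powAdj G r x y ≡ powAdj G r y x
  powAdj-sym r x y = cong₂ (λ a b → not a ∧ b) (≟-sym x y) (within-comm r x y)

  powAdj-irrefl : ∀ r x → powAdj G r x x ≡ false
  powAdj-irrefl r x rewrite ≟-refl x = refl

  -- The ball B(v,r) consists of v and its neighbours in G^r.
  ball≤1+powDegree : ∀ r v → count (within G r v) ≤ suc (count (powAdj G r v))
  ball≤1+powDegree r v = begin
    count (within G r v)                                ≤⟨ count-mono cover ⟩
    count (λ y → ⌊ v ≟ y ⌋ ∨ powAdj G r v y)            ≡⟨ count-∪ _ _ disjoint ⟨
    count (λ y → ⌊ v ≟ y ⌋) + count (powAdj G r v)      ≡⟨ cong (_+ count (powAdj G r v)) (count-≟ v) ⟩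
    suc (count (powAdj G r v))                          ∎
    where
    open ≤-Reasoning
    cover : ∀ y → within G r v y ≡ true → ⌊ v ≟ y ⌋ ∨ powAdj G r v y ≡ true
    cover y vy with ⌊ v ≟ y ⌋
    ... | true  = refl
    ... | false = vy

    disjoint : ∀ y → ⌊ v ≟ y ⌋ ≡ true → powAdj G r v y ≡ false
    disjoint y v≡y rewrite v≡y = refl

  no-neighbour-within : ∀ v s x → within G (suc s) v x ≡ false →
                        ∀ y → within G s v y ≡ true → adj G x y ≡ false
  no-neighbour-within v s x ¬vx y vy with adj G x y in xy
  ... | false = refl
  ... | true  = ⊥-elim (true≢false (within-snoc s v y x vy (trans (Graph.sym G y x) xy)) ¬vx)

  module Regular (d : ℕ) (regular : ∀ v → degree G v ≡ d) where

    -- If x is at distance exactly t+1 from v and I ⊆ B(v,t) contains no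
    -- neighbour of x, then x, its d neighbours and I are disjoint inside B(v,t+2).
    ball-step : ∀ v t x → AtDistance v t x → (I : Fin n → Bool) →
                (∀ y → I y ≡ true → within G t v y ≡ true) →
                (∀ y → I y ≡ true → adj G x y ≡ false) →
                suc d + count I ≤ count (within G (2 + t) v)
    ball-step v t x (vx , ¬vx) I I⊆ball I∩N[x]=∅ = begin
      suc d + count I
        ≡⟨ cong (λ m → suc m + count I) (regular x) ⟨
      suc (count (adj G x)) + count I
        ≡⟨ cong (λ m → m + count (adj G x) + count I) (count-≟ x) ⟨
      count (λ y → ⌊ x ≟ y ⌋) + count (adj G x) + count I
        ≡⟨ cong (_+ count I) (count-∪ (λ y → ⌊ x ≟ y ⌋) (adj G x) x∉N[x]) ⟩
      count N[x] + count I
        ≡⟨ count-∪ N[x] I N[x]∩I=∅ ⟩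
      count (λ y → N[x] y ∨ I y)
        ≤⟨ count-mono ⊆ball ⟩
      count (within G (2 + t) v)
        ∎
      where
      open ≤-Reasoning
      N[x] : Fin n → Bool
      N[x] y = ⌊ x ≟ y ⌋ ∨ adj G x y

      x∉N[x] : ∀ y → ⌊ x ≟ y ⌋ ≡ true → adj G x y ≡ false
      x∉N[x] y x≡y with ≟-sound {x = x} x≡y
      ... | refl = Graph.loopless G x

      N[x]∩I=∅ : ∀ y → N[x] y ≡ true → I y ≡ false
      N[x]∩I=∅ y h with I y in Iy
      ... | false = refl
      ... | true with ⌊ x ≟ y ⌋ in x≡y
      ...   | true  rewrite ≟-sound {x = x} x≡y = ⊥-elim (true≢false (I⊆ball y Iy) ¬vx)
      ...   | false = ⊥-elim (true≢false h (I∩N[x]=∅ y Iy))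

      ⊆ball : ∀ y → N[x] y ∨ I y ≡ true → within G (2 + t) v y ≡ true
      ⊆ball y h with ⌊ x ≟ y ⌋ in x≡y | adj G x y in xy | I y in Iy
      ... | true  | _     | _    rewrite ≟-sound {x = x} x≡y = within-suc (suc t) v y vx
      ... | false | true  | _    = within-snoc (suc t) v x y vx xy
      ... | false | false | true = within-mono (n≤1+n (suc t)) v y (within-suc t v y (I⊆ball y Iy))

    radius : ℕ → ℕ
    radius j = j * 3 + 2

    ball-growth : Connected G → ∀ v j → suc j * suc d ≤ count (within G (radius j) v)
                                      ⊎ (∀ y → within G (radius j) v y ≡ true)
    ball-growth connected v zero with grows-or-stable v 0
    ... | inj₁ (x , far) =
      inj₁ (≤-trans (+-monoʳ-≤ (suc d) z≤n) (ball-step v 0 x far (λ _ → false) (λ _ ()) (λ _ ())))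
    ... | inj₂ stable = inj₂ (λ y → within-mono {0} {2} z≤n v y (stable-full connected v 0 stable y))
    ball-growth connected v (suc j) with ball-growth connected v j | grows-or-stable v (suc (radius j))
    ... | inj₂ full | _ = inj₂ (λ y → within-mono (m≤n+m (radius j) 3) v y (full y))
    ... | inj₁ bound | inj₁ (x , far) =
      inj₁ (≤-trans (+-monoʳ-≤ (suc d) bound)
                    (ball-step v (suc (radius j)) x far (within G (radius j) v) (within-suc (radius j) v)
                               (no-neighbour-within v (radius j) x (proj₂ far))))
    ... | inj₁ _ | inj₂ stable =
      inj₂ (λ y → within-mono (m≤n+m (suc (radius j)) 2) v y
                              (stable-full connected v (suc (radius j)) stable y))

    ball-size : Connected G → ∀ r u w → within G (r ∸ 1) u w ≡ false →
                ∀ j → radius j ≤ r ∸ 1 → ∀ v → suc j * suc d ≤ count (within G r v)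
    ball-size connected r u w ¬uw j small v with ball-growth connected v j
    ... | inj₁ bound = ≤-trans bound (count-mono (within-mono small′ v))
      where small′ = ≤-trans small (m∸n≤m r 1)
    ... | inj₂ full = begin
      suc j * suc d                        ≤⟨ bound-at-u ⟩
      count (within G (radius j) u)       ≤⟨ count≤n _ ⟩
      n                                    ≡⟨ count-all n ⟨
      count {n} (λ _ → true)               ≤⟨ count-mono (λ y _ → within-mono small′ v y (full y)) ⟩
      count (within G r v)                 ∎
      where
      open ≤-Reasoning
      small′ : radius j ≤ r
      small′ = ≤-trans small (m∸n≤m r 1)
      -- the ball around u cannot be full, since it misses w
      bound-at-u : suc j * suc d ≤ count (within G (radius j) u)
      bound-at-u with ball-growth connected u j
      ... | inj₁ bound = bound
      ... | inj₂ fullᵤ = ⊥-elim (true≢false (within-mono small u w (fullᵤ w)) ¬uw)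

    edges-regular : 2 * e G ≡ n * d
    edges-regular = trans (handshake (adj G) (Graph.sym G) (Graph.loopless G))
                          (trans (sum-cong-≗ regular) (∑-const n d))

    power-edges : Connected G → ∀ r u w → within G (r ∸ 1) u w ≡ false →
                  ∀ j → radius j ≤ r ∸ 1 → suc j * e G ≤ ePow G r
    power-edges connected r u w ¬uw j small = *-cancelˡ-≤ 2 (begin
      2 * (k * e G)                        ≡⟨ x∙yz≈y∙xz 2 k (e G) ⟩
      k * (2 * e G)                        ≡⟨ cong (k *_) edges-regular ⟩
      k * (n * d)                          ≡⟨ x∙yz≈y∙xz k n d ⟩
      n * (k * d)                          ≡⟨ ∑-const n (k * d) ⟨
      ∑[ v < n ] (k * d)                   ≤⟨ ∑-mono powDegree ⟩
      ∑[ v < n ] count (powAdj G r v)      ≡⟨ handshake (powAdj G r) (powAdj-sym r) (powAdj-irrefl r) ⟨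
      2 * ePow G r                         ∎)
      where
      open ≤-Reasoning
      k : ℕ
      k = suc j

      powDegree : ∀ v → k * d ≤ count (powAdj G r v)
      powDegree v = ≤-pred (begin
        suc (k * d)                  ≤⟨ s≤s (m≤n+m (k * d) j) ⟩
        k + k * d                    ≡⟨ *-suc k d ⟨
        k * suc d                    ≤⟨ ball-size connected r u w ¬uw j small v ⟩
        count (within G r v)         ≤⟨ ball≤1+powDegree r v ⟩
        suc (count (powAdj G r v))   ∎)

-- ⌈r/3⌉ - 1 = j+1 means 3(j+2) ≤ r+2, so 3j+2 ≤ r-1.
ceil3-radius : ∀ r j → ceil3 r ∸ 1 ≡ suc j → j * 3 + 2 ≤ r ∸ 1
ceil3-radius r j eq with (r + 2) / 3 | m/n*n≤m (r + 2) 3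
... | suc (suc c) | q*3≤r+2 with eq
...   | refl = begin
  j * 3 + 2                  ≡⟨ +-comm (j * 3) 2 ⟩
  2 + j * 3                  ≤⟨ n≤1+n _ ⟩
  (4 + j * 3) ∸ 1            ≤⟨ ∸-monoˡ-≤ 1 (≤-pred (≤-pred (≤-trans q*3≤r+2 (≤-reflexive (+-comm r 2))))) ⟩
  r ∸ 1                      ∎
  where open ≤-Reasoning

theorem3 : ∀ {n : ℕ} (G : Graph n) → Regular G → Connected G →
           (r : ℕ) → 1 ≤ r → DiamAtLeast G r →
           (ceil3 r ∸ 1) * e G ≤ ePow G r
theorem3 G (d , regular) connected r _ (u , w , ¬uw) with ceil3 r ∸ 1 in eq
... | zero  = z≤n
... | suc j = Balls.Regular.power-edges G d regular connected r u w ¬uw j (ceil3-radius r j eq)
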